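{- Let $n$ be a positive integer with $2\mid n$ and $5\| n$ (i.e. $5\mid n$ and $25\nmid n$). Then $n$ is neither near superperfect nor deficient superperfect.
   Context: $\sigma(m)$ denotes the sum of the positive divisors of $m$. A positive integer $n$ is near superperfect if $2n+d=\sigma(\sigma(n))$ for some positive divisor $d$ of $n$, and deficient superperfect if $2n-d=\sigma(\sigma(n))$ for some positive divisor $d$ of $n$. -}

module Defs where

open import Data.Nat using (ℕ; zero; suc; _+_; _*_; _∸_; _<_)
open import Data.Nat.Divisibility using (_∣_; _∣?_)
open import Data.List using (List; filter; upTo; map)
open import Data.Nat.ListAction using (sum)
open import Relation.Binary.PropositionalEquality using (_≡_)
open import Data.Product using (Σ; _×_)

-- σ m = sum of positive divisors of m: sum of d ∈ {1,…,m} with d ∣ m (σ 0 = 0).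
σ : ℕ → ℕ
σ m = sum (filter (_∣? m) (map suc (upTo m)))

NearSuperperfect : ℕ → Set
NearSuperperfect n = Σ ℕ λ d → (0 < d × d ∣ n) × (2 * n + d ≡ σ (σ n))

-- n is deficient superperfect: 2n - d = σ(σ(n)) for some positive divisor d of n
-- (d ∣ n, n > 0 gives d ≤ n < 2n, so truncated subtraction is exact)
DeficientSuperperfect : ℕ → Set
DeficientSuperperfect n = Σ ℕ λ d → (0 < d × d ∣ n) × (2 * n ∸ d ≡ σ (σ n))

{-# OPTIONS --safe #-}
-- Write n = 10 t with 5 ∤ 2 t.  Pairing each divisor d of 2 t with 5 d gives σ n = 6 σ (2 t),
-- and since k s has the divisors d s for d ∣ k, σ (k s) ≥ σ k · s.  Hence σ n ≥ σ 10 · t = 18 t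
-- and σ (σ n) ≥ σ 6 · σ (2 t) = 2 σ n ≥ 36 t > 3 n, which exceeds both 2 n + d and 2 n ∸ d.
module Submission where

open import Defs
open import Data.Nat using (ℕ; zero; suc; _+_; _*_; _≤_; _<_; _<?_; _≤′_; ≤′-refl; ≤′-step; z≤n; s≤s; NonZero; >-nonZero; >-nonZero⁻¹)
open import Data.Nat.Properties
open import Data.Nat.Divisibility
open import Data.Nat.Coprimality using (Coprime; coprime-divisor)
open import Data.Nat.LCM using (lcm-least)
open import Data.Nat.Primality using (Prime; prime⇒irreducible; prime⇒nonZero; prime?)
open import Data.Nat.ListAction using (sum)
open import Data.Nat.ListAction.Properties using (sum-++)
open import Data.List using ([]; _∷_; filter; upTo; map; _++_)
open import Data.List.Properties using (upTo-∷ʳ; map-++; filter-++)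
open import Data.Product using (_×_; _,_)
open import Data.Sum using (inj₁; inj₂)
open import Relation.Nullary using (¬_; yes; no; contradiction)
open import Relation.Nullary.Decidable using (from-yes)
open import Relation.Binary.PropositionalEquality
open import Data.Nat.Tactic.RingSolver using (solve-∀)

divisorTerm : ℕ → ℕ → ℕ
divisorTerm m i with i ∣? m
... | yes _ = i
... | no _ = 0

divisorTerm-∣ : ∀ {m i} → i ∣ m → divisorTerm m i ≡ i
divisorTerm-∣ {m} {i} i∣m with i ∣? m
... | yes _ = refl
... | no i∤m = contradiction i∣m i∤m

divisorTerm-∤ : ∀ {m i} → ¬ i ∣ m → divisorTerm m i ≡ 0
divisorTerm-∤ {m} {i} i∤m with i ∣? m
... | yes i∣m = contradiction i∣m i∤m
... | no _ = refl

divisorTerm-*-* : ∀ m i p .{{_ : NonZero p}} → divisorTerm (m * p) (i * p) ≡ divisorTerm m i * p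
divisorTerm-*-* m i p with i ∣? m
... | yes i∣m = divisorTerm-∣ (*-monoˡ-∣ p i∣m)
... | no i∤m = divisorTerm-∤ (λ ip∣mp → i∤m (*-cancelʳ-∣ p ip∣mp))

divisorTerm-*-coprime : ∀ {m i p} → Coprime i p → divisorTerm (m * p) i ≡ divisorTerm m i
divisorTerm-*-coprime {m} {i} {p} i⊥p with i ∣? m
... | yes i∣m = divisorTerm-∣ (∣m⇒∣m*n p i∣m)
... | no i∤m = divisorTerm-∤ (λ i∣mp → i∤m (coprime-divisor i⊥p (subst (i ∣_) (*-comm m p) i∣mp)))

divisorTerm-multiple : ∀ {m p} → ¬ p ∣ m → ∀ i → divisorTerm m (i * p) ≡ 0
divisorTerm-multiple {p = p} p∤m i = divisorTerm-∤ (λ ip∣m → p∤m (m*n∣⇒n∣ i p ip∣m))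

σ-upTo : ℕ → ℕ → ℕ
σ-upTo m zero = 0
σ-upTo m (suc N) = σ-upTo m N + divisorTerm m (suc N)

sum-filter-∣≡σ-upTo : ∀ m N → sum (filter (_∣? m) (map suc (upTo N))) ≡ σ-upTo m N
sum-filter-∣≡σ-upTo m zero = refl
sum-filter-∣≡σ-upTo m (suc N) = begin
  sum (filter (_∣? m) (map suc (upTo (suc N))))
    ≡⟨ cong (λ is → sum (filter (_∣? m) (map suc is))) (sym (upTo-∷ʳ N)) ⟩
  sum (filter (_∣? m) (map suc (upTo N ++ N ∷ [])))
    ≡⟨ cong (λ is → sum (filter (_∣? m) is)) (map-++ suc (upTo N) (N ∷ [])) ⟩
  sum (filter (_∣? m) (map suc (upTo N) ++ suc N ∷ []))
    ≡⟨ cong sum (filter-++ (_∣? m) (map suc (upTo N)) (suc N ∷ [])) ⟩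
  sum (filter (_∣? m) (map suc (upTo N)) ++ filter (_∣? m) (suc N ∷ []))
    ≡⟨ sum-++ (filter (_∣? m) (map suc (upTo N))) _ ⟩
  sum (filter (_∣? m) (map suc (upTo N))) + sum (filter (_∣? m) (suc N ∷ []))
    ≡⟨ cong₂ _+_ (sum-filter-∣≡σ-upTo m N) (sum-filter-singleton (suc N)) ⟩
  σ-upTo m (suc N) ∎
  where
  open ≡-Reasoning
  sum-filter-singleton : ∀ i → sum (filter (_∣? m) (i ∷ [])) ≡ divisorTerm m i
  sum-filter-singleton i with i ∣? m
  ... | yes _ = +-identityʳ i
  ... | no _ = refl

σ≡σ-upTo : ∀ m → σ m ≡ σ-upTo m m
σ≡σ-upTo m = sum-filter-∣≡σ-upTo m m

σ-upTo-mono : ∀ m {a b} → a ≤′ b → σ-upTo m a ≤ σ-upTo m b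
σ-upTo-mono m ≤′-refl = ≤-refl
σ-upTo-mono m (≤′-step a≤′b) = ≤-trans (σ-upTo-mono m a≤′b) (m≤m+n _ _)

σ-upTo-+-divisorTerm : ∀ m {a b} → a < b → σ-upTo m a + divisorTerm m b ≤ σ-upTo m b
σ-upTo-+-divisorTerm m (s≤s a≤b) = +-monoˡ-≤ _ (σ-upTo-mono m (≤⇒≤′ a≤b))

σ-upTo-stable : ∀ {m N} .{{_ : NonZero m}} → m ≤′ N → σ-upTo m N ≡ σ-upTo m m
σ-upTo-stable ≤′-refl = refl
σ-upTo-stable {m} {suc N} (≤′-step m≤′N) = begin
  σ-upTo m N + divisorTerm m (suc N) ≡⟨ cong (σ-upTo m N +_) (divisorTerm-∤ 1+N∤m) ⟩
  σ-upTo m N + 0                     ≡⟨ +-identityʳ _ ⟩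
  σ-upTo m N                         ≡⟨ σ-upTo-stable m≤′N ⟩
  σ-upTo m m                         ∎
  where
  open ≡-Reasoning
  1+N∤m : ¬ suc N ∣ m
  1+N∤m 1+N∣m = <⇒≱ (s≤s (≤′⇒≤ m≤′N)) (∣⇒≤ 1+N∣m)

σ-upTo[k]*s≤σ-upTo[k*s] : ∀ k s .{{_ : NonZero s}} N → σ-upTo k N * s ≤ σ-upTo (k * s) (N * s)
σ-upTo[k]*s≤σ-upTo[k*s] k s zero = ≤-refl
σ-upTo[k]*s≤σ-upTo[k*s] k s (suc N) = begin
  (σ-upTo k N + divisorTerm k (suc N)) * s           ≡⟨ *-distribʳ-+ s (σ-upTo k N) _ ⟩
  σ-upTo k N * s + divisorTerm k (suc N) * s         ≤⟨ +-monoˡ-≤ _ (σ-upTo[k]*s≤σ-upTo[k*s] k s N) ⟩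
  σ-upTo (k * s) (N * s) + divisorTerm k (suc N) * s ≡⟨ cong (σ-upTo (k * s) (N * s) +_) (divisorTerm-*-* k (suc N) s) ⟨
  σ-upTo (k * s) (N * s) + divisorTerm (k * s) (suc N * s)
    ≤⟨ σ-upTo-+-divisorTerm (k * s) (m<n+m (N * s) (>-nonZero⁻¹ s)) ⟩
  σ-upTo (k * s) (suc N * s)                         ∎
  where open ≤-Reasoning

σ[k]*s≤σ[k*s] : ∀ k s → σ k * s ≤ σ (k * s)
σ[k]*s≤σ[k*s] k zero = ≤-trans (≤-reflexive (*-zeroʳ (σ k))) z≤n
σ[k]*s≤σ[k*s] k s@(suc _) = begin
  σ k * s                    ≡⟨ cong (_* s) (σ≡σ-upTo k) ⟩
  σ-upTo k k * s             ≤⟨ σ-upTo[k]*s≤σ-upTo[k*s] k s k ⟩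
  σ-upTo (k * s) (k * s)     ≡⟨ σ≡σ-upTo (k * s) ⟨
  σ (k * s)                  ∎
  where open ≤-Reasoning

prime∤⇒coprime : ∀ {p i} → Prime p → ¬ p ∣ i → Coprime i p
prime∤⇒coprime prime-p p∤i (d∣i , d∣p) with prime⇒irreducible prime-p d∣p
... | inj₁ d≡1 = d≡1
... | inj₂ refl = contradiction d∣i p∤i

∤r+j*p : ∀ {p r} j .{{_ : NonZero r}} → r < p → ¬ p ∣ r + j * p
∤r+j*p {p} {r} j r<p p∣r+jp = <⇒≱ r<p (∣⇒≤ p∣r)
  where
  p∣r : p ∣ r
  p∣r = ∣m+n∣m⇒∣n (subst (p ∣_) (+-comm r (j * p)) p∣r+jp) (n∣m*n j)

-- Writing N = r + j * p, the divisors of m * p up to N are those of m up to N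
-- (the ones prime to p) together with p times those of m up to j.
σ-upTo-*-prime : ∀ {m p} → Prime p → ¬ p ∣ m → ∀ j r → r < p →
                 σ-upTo (m * p) (r + j * p) ≡ σ-upTo m (r + j * p) + σ-upTo m j * p
σ-upTo-*-prime prime-p p∤m zero zero _ = refl
σ-upTo-*-prime {m} {p} prime-p p∤m j (suc r) r<p = begin
  σ-upTo (m * p) (r + j * p) + divisorTerm (m * p) (suc r + j * p)
    ≡⟨ cong₂ _+_ (σ-upTo-*-prime prime-p p∤m j r (<-trans (n<1+n r) r<p))
                 (divisorTerm-*-coprime (prime∤⇒coprime prime-p (∤r+j*p j r<p))) ⟩
  σ-upTo m (r + j * p) + σ-upTo m j * p + divisorTerm m (suc r + j * p)
    ≡⟨ +-swapʳ (σ-upTo m (r + j * p)) (σ-upTo m j * p) _ ⟩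
  σ-upTo m (r + j * p) + divisorTerm m (suc r + j * p) + σ-upTo m j * p ∎
  where
  open ≡-Reasoning
  +-swapʳ : ∀ a b c → a + b + c ≡ a + c + b
  +-swapʳ = solve-∀
σ-upTo-*-prime {m} {p@(suc p-1)} prime-p p∤m (suc j) zero _ = begin
  σ-upTo (m * p) (p-1 + j * p) + divisorTerm (m * p) (suc j * p)
    ≡⟨ cong₂ _+_ (σ-upTo-*-prime prime-p p∤m j p-1 ≤-refl) (divisorTerm-*-* m (suc j) p) ⟩
  σ-upTo m (p-1 + j * p) + σ-upTo m j * p + divisorTerm m (suc j) * p
    ≡⟨ regroup (σ-upTo m (p-1 + j * p)) (σ-upTo m j) (divisorTerm m (suc j)) ⟩
  σ-upTo m (p-1 + j * p) + 0 + (σ-upTo m j + divisorTerm m (suc j)) * p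
    ≡⟨ cong (λ x → σ-upTo m (p-1 + j * p) + x + σ-upTo m (suc j) * p) (divisorTerm-multiple p∤m (suc j)) ⟨
  σ-upTo m (p-1 + j * p) + divisorTerm m (suc j * p) + σ-upTo m (suc j) * p ∎
  where
  open ≡-Reasoning
  regroup : ∀ a b c → a + b * p + c * p ≡ a + 0 + (b + c) * p
  regroup = solve-∀

σ-*-prime : ∀ {m p} → Prime p → ¬ p ∣ m → σ (m * p) ≡ σ m * suc p
σ-*-prime {zero} {p} _ p∤0 = contradiction (p ∣0) p∤0
σ-*-prime {m@(suc _)} {p} prime-p p∤m = begin
  σ (m * p)                          ≡⟨ σ≡σ-upTo (m * p) ⟩
  σ-upTo (m * p) (m * p)             ≡⟨ σ-upTo-*-prime prime-p p∤m m 0 (>-nonZero⁻¹ p) ⟩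
  σ-upTo m (m * p) + σ-upTo m m * p  ≡⟨ cong (_+ σ-upTo m m * p) (σ-upTo-stable (≤⇒≤′ (m≤m*n m p))) ⟩
  σ-upTo m m + σ-upTo m m * p        ≡⟨ *-suc (σ-upTo m m) p ⟨
  σ-upTo m m * suc p                 ≡⟨ cong (_* suc p) (σ≡σ-upTo m) ⟨
  σ m * suc p                        ∎
  where
  open ≡-Reasoning
  instance
    _ : NonZero p
    _ = prime⇒nonZero prime-p

3n<σσn⇒¬NearSuperperfect : ∀ {n} → 0 < n → 3 * n < σ (σ n) → ¬ NearSuperperfect n
3n<σσn⇒¬NearSuperperfect {n} 0<n 3n<σσn (d , (_ , d∣n) , 2n+d≡σσn) = <⇒≱ 3n<σσn (begin
  σ (σ n)    ≡⟨ 2n+d≡σσn ⟨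
  2 * n + d  ≤⟨ +-monoʳ-≤ (2 * n) (∣⇒≤ ⦃ >-nonZero 0<n ⦄ d∣n) ⟩
  2 * n + n  ≡⟨ +-comm (2 * n) n ⟩
  3 * n      ∎)
  where open ≤-Reasoning

2n<σσn⇒¬DeficientSuperperfect : ∀ {n} → 2 * n < σ (σ n) → ¬ DeficientSuperperfect n
2n<σσn⇒¬DeficientSuperperfect {n} 2n<σσn (d , _ , 2n∸d≡σσn) =
  <⇒≱ 2n<σσn (subst (_≤ 2 * n) 2n∸d≡σσn (m∸n≤m (2 * n) d))

σσ[10t]≥36t : ∀ t → ¬ 5 ∣ 2 * t → 36 * t ≤ σ (σ (10 * t))
σσ[10t]≥36t t 5∤2t = begin
  36 * t              ≡⟨ *-assoc 2 18 t ⟩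
  2 * (σ 10 * t)      ≤⟨ *-monoʳ-≤ 2 (σ[k]*s≤σ[k*s] 10 t) ⟩
  2 * σ (10 * t)      ≡⟨ cong (2 *_) σ[10t]≡6s ⟩
  2 * (6 * s)         ≡⟨ *-assoc 2 6 s ⟨
  σ 6 * s             ≤⟨ σ[k]*s≤σ[k*s] 6 s ⟩
  σ (6 * s)           ≡⟨ cong σ σ[10t]≡6s ⟨
  σ (σ (10 * t))      ∎
  where
  open ≤-Reasoning
  s = σ (2 * t)
  σ[10t]≡6s : σ (10 * t) ≡ 6 * s
  σ[10t]≡6s = begin-equality
    σ (10 * t)     ≡⟨ cong σ (trans (*-assoc 5 2 t) (*-comm 5 (2 * t))) ⟩
    σ (2 * t * 5)  ≡⟨ σ-*-prime (from-yes (prime? 5)) 5∤2t ⟩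
    s * 6          ≡⟨ *-comm s 6 ⟩
    6 * s          ∎

mainTheorem17 : (n : ℕ) → 0 < n → 2 ∣ n → 5 ∣ n → ¬ (25 ∣ n) →
    ¬ NearSuperperfect n × ¬ DeficientSuperperfect n
mainTheorem17 n 0<n 2∣n 5∣n 25∤n =
  3n<σσn⇒¬NearSuperperfect 0<n 3n<σσn ,
  2n<σσn⇒¬DeficientSuperperfect (≤-<-trans (m≤n+m (2 * n) n) 3n<σσn)
  where
  10∣n : 10 ∣ n
  10∣n = lcm-least 2∣n 5∣n
  t = quotient 10∣n
  n≡10t : n ≡ 10 * t
  n≡10t = m∣n⇒n≡m*quotient 10∣n
  instance
    _ : NonZero t
    _ = quotient≢0 10∣n ⦃ >-nonZero 0<n ⦄
  5∤2t : ¬ 5 ∣ 2 * t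
  5∤2t 5∣2t = 25∤n (subst (25 ∣_) (trans (sym (*-assoc 5 2 t)) (sym n≡10t)) (*-monoʳ-∣ 5 5∣2t))
  3n<σσn : 3 * n < σ (σ n)
  3n<σσn = begin-strict
    3 * n            ≡⟨ cong (3 *_) n≡10t ⟩
    3 * (10 * t)     ≡⟨ *-assoc 3 10 t ⟨
    30 * t           <⟨ *-monoˡ-< t (from-yes (30 <? 36)) ⟩
    36 * t           ≤⟨ σσ[10t]≥36t t 5∤2t ⟩
    σ (σ (10 * t))   ≡⟨ cong (λ m → σ (σ m)) n≡10t ⟨
    σ (σ n)          ∎
    where open ≤-Reasoning
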